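{- Let $\lambda\in\mathbb{R}$, $k,n\in\mathbb{N}$ with $k\le n-1$, and $x\in[0,1]$. Then $$\bigl(1-x-(n-k-1)\lambda\bigr)B_{k,n-1}(x|\lambda)+\bigl(x-(k-1)\lambda\bigr)B_{k-1,n-1}(x|\lambda)=B_{k,n}(x|\lambda).$$
   Context: For $\lambda\in\mathbb{R}$, $(x)_{0,\lambda}=1$ and $(x)_{n,\lambda}=x(x-\lambda)\cdots(x-(n-1)\lambda)$ for $n\ge1$. For integers $0\le k\le n$ and $x\in[0,1]$, the degenerate Bernstein polynomials are $B_{k,n}(x|\lambda)=\binom{n}{k}(x)_{k,\lambda}(1-x)_{n-k,\lambda}$. -}

module Defs where

open import Level using (Level)
open import Data.Nat using (ℕ; zero; suc)
open import Data.Nat.Combinatorics using (_C_)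
open import Algebra.Bundles using (CommutativeRing)

-- Everything is stated over an arbitrary commutative ring R
-- (the paper's setting is R = ℝ; ℝ is not available in agda-stdlib).
module DegBernstein {c ℓ : Level} (R : CommutativeRing c ℓ) where
  open CommutativeRing R

  _·_ : ℕ → Carrier → Carrier
  zero  · a = 0#
  suc m · a = a + (m · a)

  fall : Carrier → ℕ → Carrier → Carrier
  fall x zero    lam = 1#
  fall x (suc n) lam = fall x n lam * (x - (n · lam))

  binom : ℕ → ℕ → Carrier
  binom n k = (n C k) · 1#

  -- degenerate Bernstein polynomial B_{k,n}(x|λ) = C(n,k) (x)_{k,λ} (1-x)_{n-k,λ}
  -- (only used for k ≤ n in the theorem; for k > n, C(n,k) = 0 so it is 0)
  B : ℕ → ℕ → Carrier → Carrier → Carrier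
  B k n x lam = binom n k * (fall x k lam * fall (1# - x) (n Data.Nat.∸ k) lam)

  -- B_{k-1,n}(x|λ), with the standard convention B_{-1,n} = 0
  Bpred : ℕ → ℕ → Carrier → Carrier → Carrier
  Bpred zero    n x lam = 0#
  Bpred (suc k) n x lam = B k n x lam

  -- (k - 1) λ  as a ring element (equals -λ when k = 0)
  predScale : ℕ → Carrier → Carrier
  predScale k lam = (k · lam) - lam

{-# OPTIONS --safe #-}
module Submission where

-- Peeling the last factor off (1-x)_{m+1-k,λ} and off (x)_{k,λ} shows that both summands are
-- binomial multiples of the same product (x)_{k,λ} (1-x)_{m+1-k,λ}, with coefficients
-- C(m,k) and C(m,k-1); Pascal's rule C(m,k) + C(m,k-1) = C(m+1,k) finishes.

open import Defs
open import Level using (Level)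
open import Data.Nat using (ℕ; zero; suc; _∸_; s≤s) renaming (_≤_ to _≤ℕ_; _+_ to _+ℕ_)
open import Data.Nat.Properties using (+-∸-assoc)
open import Data.Nat.Combinatorics using (_C_; nCk+nC[k+1]≡[n+1]C[k+1])
open import Algebra.Bundles using (CommutativeRing)
import Relation.Binary.PropositionalEquality as ≡
import Relation.Binary.Reasoning.Setoid as SetoidReasoning
import Algebra.Solver.Ring.NaturalCoefficients.Default as NaturalCoefficientsSolver

module DegBernsteinProperties {c ℓ : Level} (R : CommutativeRing c ℓ) where
  open CommutativeRing R
  open DegBernstein R
  open NaturalCoefficientsSolver commutativeSemiring using (solve; _:=_; _:+_; _:*_; con)
  open SetoidReasoning setoid

  ·-distribʳ-+ : ∀ p q a → (p +ℕ q) · a ≈ (p · a) + (q · a)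
  ·-distribʳ-+ zero    q a = sym (+-identityˡ _)
  ·-distribʳ-+ (suc p) q a = trans (+-congˡ (·-distribʳ-+ p q a)) (sym (+-assoc _ _ _))

  binom-pascal : ∀ n k → binom (suc n) (suc k) ≈ binom n k + binom n (suc k)
  binom-pascal n k = begin
    (suc n C suc k) · 1#            ≡⟨ ≡.cong (_· 1#) (nCk+nC[k+1]≡[n+1]C[k+1] n k) ⟨
    (n C k +ℕ n C suc k) · 1#       ≈⟨ ·-distribʳ-+ (n C k) (n C suc k) 1# ⟩
    binom n k + binom n (suc k)     ∎

  predScale-suc : ∀ k lam → predScale (suc k) lam ≈ k · lam
  predScale-suc k lam = begin
    (lam + k · lam) - lam    ≈⟨ +-congʳ (+-comm lam (k · lam)) ⟩
    (k · lam + lam) - lam    ≈⟨ +-assoc (k · lam) lam (- lam) ⟩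
    k · lam + (lam - lam)    ≈⟨ +-congˡ (-‿inverseʳ lam) ⟩
    k · lam + 0#             ≈⟨ +-identityʳ _ ⟩
    k · lam                  ∎

  fall-suc-∸ : ∀ {k m} → k ≤ℕ m → ∀ y lam →
               fall y (suc m ∸ k) lam ≈ fall y (m ∸ k) lam * (y - (m ∸ k) · lam)
  fall-suc-∸ k≤m y lam = reflexive (≡.cong (λ j → fall y j lam) (+-∸-assoc 1 k≤m))

  B-zero-suc : ∀ m x lam → B 0 (suc m) x lam ≈ (1# - x - m · lam) * B 0 m x lam
  B-zero-suc m x lam =
    solve 3 (λ t c b → c :* (con 1 :* (b :* t)) := t :* (c :* (con 1 :* b)))
          refl (1# - x - m · lam) (binom m 0) (fall (1# - x) m lam)

  pascal-combination : ∀ t y c₁ c₂ a b →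
    t * (c₁ * ((a * y) * b)) + y * (c₂ * (a * (b * t))) ≈ (c₂ + c₁) * ((a * y) * (b * t))
  pascal-combination =
    solve 6 (λ t y c₁ c₂ a b →
               t :* (c₁ :* ((a :* y) :* b)) :+ y :* (c₂ :* (a :* (b :* t)))
            := (c₂ :+ c₁) :* ((a :* y) :* (b :* t)))
          refl

  B-recurrence : ∀ lam k m x → k ≤ℕ m →
    (1# - x - (m ∸ k) · lam) * B k m x lam + (x - predScale k lam) * Bpred k m x lam
      ≈ B k (suc m) x lam
  B-recurrence lam zero m x _ = begin
    t * B 0 m x lam + (x - predScale 0 lam) * 0#   ≈⟨ +-congˡ (zeroʳ _) ⟩
    t * B 0 m x lam + 0#                           ≈⟨ +-identityʳ _ ⟩
    t * B 0 m x lam                                ≈⟨ B-zero-suc m x lam ⟨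
    B 0 (suc m) x lam                              ∎
    where t = 1# - x - m · lam
  B-recurrence lam (suc k) (suc m) x (s≤s k≤m) = begin
    t * (c₁ * ((a * y) * b)) + (x - predScale (suc k) lam) * (c₂ * (a * b′))
      ≈⟨ +-congˡ (*-cong (+-congˡ (-‿cong (predScale-suc k lam)))
                         (*-congˡ (*-congˡ (fall-suc-∸ k≤m (1# - x) lam)))) ⟩
    t * (c₁ * ((a * y) * b)) + y * (c₂ * (a * (b * t)))
      ≈⟨ pascal-combination t y c₁ c₂ a b ⟩
    (c₂ + c₁) * ((a * y) * (b * t))
      ≈⟨ *-cong (sym (binom-pascal (suc m) k))
                (*-congˡ (sym (fall-suc-∸ k≤m (1# - x) lam))) ⟩
    binom (suc (suc m)) (suc k) * ((a * y) * b′)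
      ∎
    where
    t  = 1# - x - (m ∸ k) · lam
    y  = x - k · lam
    a  = fall x k lam
    b  = fall (1# - x) (m ∸ k) lam
    b′ = fall (1# - x) (suc m ∸ k) lam
    c₁ = binom (suc m) (suc k)
    c₂ = binom (suc m) k

theorem2p5 : {c ℓ ℓ' : Level} (R : CommutativeRing c ℓ)
    → (_≤_ : CommutativeRing.Carrier R → CommutativeRing.Carrier R → Set ℓ')
    → let open CommutativeRing R in
      let open DegBernstein R in
      (lam : Carrier) (k m : ℕ) (x : Carrier)
    → k ≤ℕ m
    → 0# ≤ x → x ≤ 1#
    → ((1# - x - ((m ∸ k) · lam)) * B k m x lam)
        + ((x - predScale k lam) * Bpred k m x lam)
        ≈ B k (suc m) x lam
theorem2p5 R _ lam k m x k≤m _ _ = DegBernsteinProperties.B-recurrence R lam k m x k≤m
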